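{- $\mathcal{F}SN$ is sound with respect to $\mathsf{R}^{sn}$: for every $\varphi\in\mathcal{F}SN$ and every $\mathfrak{R}\in\mathsf{R}^{sn}$, $\mathfrak{R}\vDash\varphi$.
   Context: Let $\Phi=\{p_0,p_1,\dots\}$ be a countably infinite set of propositional letters; $\mathsf{FOR}$ is the set of formulas built from $\Phi$ with $\neg$ and binary $\lor,\wedge,\to,\leftrightarrow,\vartriangle,\looparrowright$. An Epstein model is $\langle v,\mathfrak{R}\rangle$ with $v:\Phi\to\{0,1\}$ and $\mathfrak{R}\subseteq\mathsf{FOR}^2$. Truth: $\langle v,\mathfrak{R}\rangle\vDash p$ iff $v(p)=1$; classical clauses for $\neg,\wedge,\lor,\to,\leftrightarrow$; $\vDash\psi\vartriangle\chi$ iff both $\psi,\chi$ true and $\langle\psi,\chi\rangle\in\mathfrak{R}$; $\vDash\psi\looparrowright\chi$ iff ($\psi$ false or $\chi$ true) and $\langle\psi,\chi\rangle\in\mathfrak{R}$. $\mathfrak{R}\vDash\varphi$ iff $\langle v,\mathfrak{R}\rangle\vDash\varphi$ for every $v$. $\mathsf{R}^{sn}$ is the set of relations $\mathfrak{R}\subseteq\mathsf{FOR}^2$ that are symmetric and satisfy: $\langle\neg\varphi,\psi\rangle\in\mathfrak{R}$ implies $\langle\varphi,\psi\rangle\in\mathfrak{R}$. $\mathcal{F}SN$ is the least set of formulas containing all classical tautologies and the axioms $(p\looparrowright q)\to(p\to q)$; $(p\vartriangle q)\leftrightarrow((p\looparrowright q)\wedge(p\wedge q))$; $(p\looparrowright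 q)\to((q\looparrowright p)\lor\neg(q\to p))$; $(\neg p\looparrowright q)\to((p\looparrowright q)\lor\neg(p\to q))$; $((\neg\neg p\looparrowright q)\wedge\neg(\neg p\to q))\to(p\looparrowright q)$; $(\neg(p\to q)\wedge(\neg p\looparrowright q))\to(q\looparrowright p)$; $(\neg(\neg p\to q)\wedge(q\looparrowright\neg p))\to(p\looparrowright q)$, closed under uniform substitution and modus ponens. -}

module Defs where

open import Data.Nat using (ℕ)
open import Data.Bool using (Bool; true; false; not; _∧_; _∨_; if_then_else_)
open import Relation.Binary.PropositionalEquality using (_≡_)

data Fml : Set where
  var  : ℕ → Fml
  ¬′_  : Fml → Fml
  _∨′_ _∧′_ _⇒′_ _⇔′_ _△_ _↬_ : Fml → Fml → Fml

infixr 6 _∧′_ _△_ _↬_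
infixr 5 _∨′_
infixr 4 _⇒′_ _⇔′_
infix 7 ¬′_

_⇒ᵇ_ : Bool → Bool → Bool
a ⇒ᵇ b = not a ∨ b

_⇔ᵇ_ : Bool → Bool → Bool
a ⇔ᵇ b = (a ⇒ᵇ b) ∧ (b ⇒ᵇ a)

Rel : Set
Rel = Fml → Fml → Bool

⟦_⟧ : Fml → (ℕ → Bool) → Rel → Bool
⟦ var n ⟧ v R = v n
⟦ ¬′ φ ⟧ v R = not (⟦ φ ⟧ v R)
⟦ φ ∨′ ψ ⟧ v R = ⟦ φ ⟧ v R ∨ ⟦ ψ ⟧ v R
⟦ φ ∧′ ψ ⟧ v R = ⟦ φ ⟧ v R ∧ ⟦ ψ ⟧ v R
⟦ φ ⇒′ ψ ⟧ v R = ⟦ φ ⟧ v R ⇒ᵇ ⟦ ψ ⟧ v R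
⟦ φ ⇔′ ψ ⟧ v R = ⟦ φ ⟧ v R ⇔ᵇ ⟦ ψ ⟧ v R
⟦ φ △ ψ ⟧ v R = (⟦ φ ⟧ v R ∧ ⟦ ψ ⟧ v R) ∧ R φ ψ
⟦ φ ↬ ψ ⟧ v R = (⟦ φ ⟧ v R ⇒ᵇ ⟦ ψ ⟧ v R) ∧ R φ ψ

_⊨_ : Rel → Fml → Set
R ⊨ φ = ∀ (v : ℕ → Bool) → ⟦ φ ⟧ v R ≡ true

record IsRsn (R : Rel) : Set where
  field
    symmetric : ∀ φ ψ → R φ ψ ≡ true → R ψ φ ≡ true
    negation  : ∀ φ ψ → R (¬′ φ) ψ ≡ true → R φ ψ ≡ true

-- Classical evaluation: letters and formulas with main connective △ or ↬
-- are treated as propositional atoms, valued by an arbitrary g.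
classical : (Fml → Bool) → Fml → Bool
classical g (var n) = g (var n)
classical g (¬′ φ) = not (classical g φ)
classical g (φ ∨′ ψ) = classical g φ ∨ classical g ψ
classical g (φ ∧′ ψ) = classical g φ ∧ classical g ψ
classical g (φ ⇒′ ψ) = classical g φ ⇒ᵇ classical g ψ
classical g (φ ⇔′ ψ) = classical g φ ⇔ᵇ classical g ψ
classical g (φ △ ψ) = g (φ △ ψ)
classical g (φ ↬ ψ) = g (φ ↬ ψ)

-- Classical tautology (of the full language, i.e. substitution instance of
-- a propositional tautology): true under every assignment to the atoms.
Tautology : Fml → Set
Tautology φ = ∀ (g : Fml → Bool) → classical g φ ≡ true

sub : (ℕ → Fml) → Fml → Fml
sub σ (var n) = σ n
sub σ (¬′ φ) = ¬′ sub σ φ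
sub σ (φ ∨′ ψ) = sub σ φ ∨′ sub σ ψ
sub σ (φ ∧′ ψ) = sub σ φ ∧′ sub σ ψ
sub σ (φ ⇒′ ψ) = sub σ φ ⇒′ sub σ ψ
sub σ (φ ⇔′ ψ) = sub σ φ ⇔′ sub σ ψ
sub σ (φ △ ψ) = sub σ φ △ sub σ ψ
sub σ (φ ↬ ψ) = sub σ φ ↬ sub σ ψ

p q : Fml
p = var 0
q = var 1

data Axiom : Fml → Set where
  ax1 : Axiom ((p ↬ q) ⇒′ (p ⇒′ q))
  ax2 : Axiom ((p △ q) ⇔′ ((p ↬ q) ∧′ (p ∧′ q)))
  ax3 : Axiom ((p ↬ q) ⇒′ ((q ↬ p) ∨′ ¬′ (q ⇒′ p)))
  ax4 : Axiom ((¬′ p ↬ q) ⇒′ ((p ↬ q) ∨′ ¬′ (p ⇒′ q)))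
  ax5 : Axiom (((¬′ ¬′ p ↬ q) ∧′ ¬′ (¬′ p ⇒′ q)) ⇒′ (p ↬ q))
  ax6 : Axiom ((¬′ (p ⇒′ q) ∧′ (¬′ p ↬ q)) ⇒′ (q ↬ p))
  ax7 : Axiom ((¬′ (¬′ p ⇒′ q) ∧′ (q ↬ ¬′ p)) ⇒′ (p ↬ q))

data FSN : Fml → Set where
  taut  : ∀ {φ} → Tautology φ → FSN φ
  axiom : ∀ {φ} → Axiom φ → FSN φ
  subst : ∀ {φ} (σ : ℕ → Fml) → FSN φ → FSN (sub σ φ)
  mp    : ∀ {φ ψ} → FSN (φ ⇒′ ψ) → FSN φ → FSN ψ

-- Evaluating sub σ φ in ⟨v, ℜ⟩ is the same as evaluating φ itself in the
-- model whose valuation reads p_n as σ n and whose relation is the pullback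
-- of ℜ, relating χ and ξ iff ℜ relates their σ-instances. Since substitution
-- commutes with ¬, pulling a relation back along σ preserves symmetry and the
-- negation condition, so validity over R^{sn} is closed under uniform
-- substitution. It is closed under modus ponens and contains the tautologies
-- because the connectives other than △ and ↬ are classical; each axiom holds
-- because the relational premise of its antecedent transfers to its
-- consequent by symmetry and the negation rule.
module Submission where

open import Defs
open IsRsn using (symmetric; negation)
open import Data.Nat using (ℕ)
open import Data.Bool using (Bool; true; false; not; _∧_; _∨_)
open import Data.Product using (_×_; _,_; proj₁; proj₂)
open import Function using (_∘_; const)
open import Relation.Binary.PropositionalEquality using (_≡_; refl; trans; cong; cong₂)

∧-pair : ∀ {a b} → a ≡ true → b ≡ true → a ∧ b ≡ true
∧-pair refl refl = refl

∧-split : ∀ a {b} → a ∧ b ≡ true → a ≡ true × b ≡ true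
∧-split true b = refl , b

⇒ᵇ-intro : ∀ a {b} → (a ≡ true → b ≡ true) → a ⇒ᵇ b ≡ true
⇒ᵇ-intro false _ = refl
⇒ᵇ-intro true  f = f refl

⇒ᵇ-elim : ∀ {a b} → a ⇒ᵇ b ≡ true → a ≡ true → b ≡ true
⇒ᵇ-elim e refl = e

Valid : Fml → Set
Valid φ = ∀ R → IsRsn R → R ⊨ φ

⟦⟧-classical : ∀ φ v R → ⟦ φ ⟧ v R ≡ classical (λ χ → ⟦ χ ⟧ v R) φ
⟦⟧-classical (var n)  v R = refl
⟦⟧-classical (¬′ φ)   v R = cong not (⟦⟧-classical φ v R)
⟦⟧-classical (φ ∨′ ψ) v R = cong₂ _∨_ (⟦⟧-classical φ v R) (⟦⟧-classical ψ v R)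
⟦⟧-classical (φ ∧′ ψ) v R = cong₂ _∧_ (⟦⟧-classical φ v R) (⟦⟧-classical ψ v R)
⟦⟧-classical (φ ⇒′ ψ) v R = cong₂ _⇒ᵇ_ (⟦⟧-classical φ v R) (⟦⟧-classical ψ v R)
⟦⟧-classical (φ ⇔′ ψ) v R = cong₂ _⇔ᵇ_ (⟦⟧-classical φ v R) (⟦⟧-classical ψ v R)
⟦⟧-classical (φ △ ψ)  v R = refl
⟦⟧-classical (φ ↬ ψ)  v R = refl

tautology-⊨ : ∀ φ R → Tautology φ → R ⊨ φ
tautology-⊨ φ R t v = trans (⟦⟧-classical φ v R) (t _)

pullback : (ℕ → Fml) → Rel → Rel
pullback σ R φ ψ = R (sub σ φ) (sub σ ψ)

⟦sub⟧ : ∀ σ φ v R → ⟦ sub σ φ ⟧ v R ≡ ⟦ φ ⟧ (λ n → ⟦ σ n ⟧ v R) (pullback σ R)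
⟦sub⟧ σ (var n)  v R = refl
⟦sub⟧ σ (¬′ φ)   v R = cong not (⟦sub⟧ σ φ v R)
⟦sub⟧ σ (φ ∨′ ψ) v R = cong₂ _∨_ (⟦sub⟧ σ φ v R) (⟦sub⟧ σ ψ v R)
⟦sub⟧ σ (φ ∧′ ψ) v R = cong₂ _∧_ (⟦sub⟧ σ φ v R) (⟦sub⟧ σ ψ v R)
⟦sub⟧ σ (φ ⇒′ ψ) v R = cong₂ _⇒ᵇ_ (⟦sub⟧ σ φ v R) (⟦sub⟧ σ ψ v R)
⟦sub⟧ σ (φ ⇔′ ψ) v R = cong₂ _⇔ᵇ_ (⟦sub⟧ σ φ v R) (⟦sub⟧ σ ψ v R)
⟦sub⟧ σ (φ △ ψ)  v R =
  cong (_∧ pullback σ R φ ψ) (cong₂ _∧_ (⟦sub⟧ σ φ v R) (⟦sub⟧ σ ψ v R))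
⟦sub⟧ σ (φ ↬ ψ)  v R =
  cong (_∧ pullback σ R φ ψ) (cong₂ _⇒ᵇ_ (⟦sub⟧ σ φ v R) (⟦sub⟧ σ ψ v R))

IsRsn-pullback : ∀ {R} σ → IsRsn R → IsRsn (pullback σ R)
IsRsn-pullback σ rs = record
  { symmetric = λ φ ψ → symmetric rs (sub σ φ) (sub σ ψ)
  ; negation  = λ φ ψ → negation rs (sub σ φ) (sub σ ψ)
  }

Valid-sub : ∀ σ φ → Valid φ → Valid (sub σ φ)
Valid-sub σ φ valid R rs v =
  trans (⟦sub⟧ σ φ v R) (valid (pullback σ R) (IsRsn-pullback σ rs) _)

Valid-mp : ∀ φ ψ → Valid (φ ⇒′ ψ) → Valid φ → Valid ψ
Valid-mp φ ψ valid-φ⇒ψ valid-φ R rs v = ⇒ᵇ-elim (valid-φ⇒ψ R rs v) (valid-φ R rs v)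

∧-⇒ᵇ-elimˡ : ∀ x r → (x ∧ r) ⇒ᵇ x ≡ true
∧-⇒ᵇ-elimˡ x r = ⇒ᵇ-intro (x ∧ r) (proj₁ ∘ ∧-split x)

△-⇔ᵇ-↬∧ : ∀ a b r → ((a ∧ b) ∧ r) ⇔ᵇ (((a ⇒ᵇ b) ∧ r) ∧ (a ∧ b)) ≡ true
△-⇔ᵇ-↬∧ a b r =
  ∧-pair (⇒ᵇ-intro ((a ∧ b) ∧ r) forth) (⇒ᵇ-intro (((a ⇒ᵇ b) ∧ r) ∧ (a ∧ b)) back)
  where
  forth : (a ∧ b) ∧ r ≡ true → ((a ⇒ᵇ b) ∧ r) ∧ (a ∧ b) ≡ true
  forth h = let a∧b , r-holds = ∧-split (a ∧ b) h
                b-holds       = proj₂ (∧-split a a∧b)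
            in ∧-pair (∧-pair (⇒ᵇ-intro a (const b-holds)) r-holds) a∧b
  back : ((a ⇒ᵇ b) ∧ r) ∧ (a ∧ b) ≡ true → (a ∧ b) ∧ r ≡ true
  back h = let a⇒b∧r , a∧b = ∧-split ((a ⇒ᵇ b) ∧ r) h
           in ∧-pair a∧b (proj₂ (∧-split (a ⇒ᵇ b) a⇒b∧r))

¬[¬a⇒b]⇒[a⇒b] : ∀ a b → not (not a ⇒ᵇ b) ≡ true → a ⇒ᵇ b ≡ true
¬[¬a⇒b]⇒[a⇒b] false b _ = refl
¬[¬a⇒b]⇒[a⇒b] true  b ()

¬[a⇒b]⇒[b⇒a] : ∀ a b → not (a ⇒ᵇ b) ≡ true → b ⇒ᵇ a ≡ true
¬[a⇒b]⇒[b⇒a] true  false _ = refl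
¬[a⇒b]⇒[b⇒a] true  true  ()
¬[a⇒b]⇒[b⇒a] false b     ()

↬-transfer-∨¬ : ∀ x y {r s} → (r ≡ true → s ≡ true) →
                (x ∧ r) ⇒ᵇ ((y ∧ s) ∨ not y) ≡ true
↬-transfer-∨¬ x y {r} r→s = ⇒ᵇ-intro (x ∧ r) (∧-∨-not y ∘ r→s ∘ proj₂ ∘ ∧-split x)
  where
  ∧-∨-not : ∀ y {s} → s ≡ true → (y ∧ s) ∨ not y ≡ true
  ∧-∨-not true  refl = refl
  ∧-∨-not false _    = refl

↬-transfer-∧ˡ : ∀ z x y {r s} → (z ≡ true → y ≡ true) → (r ≡ true → s ≡ true) →
                (z ∧ (x ∧ r)) ⇒ᵇ (y ∧ s) ≡ true
↬-transfer-∧ˡ z x y {r} z→y r→s = ⇒ᵇ-intro (z ∧ (x ∧ r)) λ h →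
  let z-holds , x∧r = ∧-split z h in
  ∧-pair (z→y z-holds) (r→s (proj₂ (∧-split x x∧r)))

↬-transfer-∧ʳ : ∀ x z y {r s} → (z ≡ true → y ≡ true) → (r ≡ true → s ≡ true) →
                ((x ∧ r) ∧ z) ⇒ᵇ (y ∧ s) ≡ true
↬-transfer-∧ʳ x z y {r} z→y r→s = ⇒ᵇ-intro ((x ∧ r) ∧ z) λ h →
  let x∧r , z-holds = ∧-split (x ∧ r) h in
  ∧-pair (z→y z-holds) (r→s (proj₂ (∧-split x x∧r)))

Axiom-valid : ∀ {φ} → Axiom φ → Valid φ
Axiom-valid ax1 R rs v = ∧-⇒ᵇ-elimˡ (v 0 ⇒ᵇ v 1) (R p q)
Axiom-valid ax2 R rs v = △-⇔ᵇ-↬∧ (v 0) (v 1) (R p q)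
Axiom-valid ax3 R rs v = ↬-transfer-∨¬ (v 0 ⇒ᵇ v 1) (v 1 ⇒ᵇ v 0) (symmetric rs p q)
Axiom-valid ax4 R rs v = ↬-transfer-∨¬ (not (v 0) ⇒ᵇ v 1) (v 0 ⇒ᵇ v 1) (negation rs p q)
Axiom-valid ax5 R rs v =
  ↬-transfer-∧ʳ (not (not (v 0)) ⇒ᵇ v 1) (not (not (v 0) ⇒ᵇ v 1)) (v 0 ⇒ᵇ v 1)
    (¬[¬a⇒b]⇒[a⇒b] (v 0) (v 1)) (negation rs p q ∘ negation rs (¬′ p) q)
Axiom-valid ax6 R rs v =
  ↬-transfer-∧ˡ (not (v 0 ⇒ᵇ v 1)) (not (v 0) ⇒ᵇ v 1) (v 1 ⇒ᵇ v 0)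
    (¬[a⇒b]⇒[b⇒a] (v 0) (v 1)) (symmetric rs p q ∘ negation rs p q)
Axiom-valid ax7 R rs v =
  ↬-transfer-∧ˡ (not (not (v 0) ⇒ᵇ v 1)) (v 1 ⇒ᵇ not (v 0)) (v 0 ⇒ᵇ v 1)
    (¬[¬a⇒b]⇒[a⇒b] (v 0) (v 1)) (negation rs p q ∘ symmetric rs q (¬′ p))

FSN-valid : ∀ {φ} → FSN φ → Valid φ
FSN-valid (taut {φ} t) R _ = tautology-⊨ φ R t
FSN-valid (axiom a)        = Axiom-valid a
FSN-valid (subst {φ} σ d)  = Valid-sub σ φ (FSN-valid d)
FSN-valid (mp {φ} {ψ} d e) = Valid-mp φ ψ (FSN-valid d) (FSN-valid e)

mainTheorem10 : ∀ (φ : Fml) (R : Rel) → IsRsn R → FSN φ → R ⊨ φ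
mainTheorem10 φ R rs d = FSN-valid d R rs
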